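{- Let $G$ be a nice graph, $V_4$ the set of vertices of degree at least $4$ in $G$, $\mathcal{P}$ a path partition of $G$, and $\mathcal{P}_4\subseteq\mathcal{P}$ the subfamily of paths that visit at least one vertex of $V_4$. Then $\mathcal{P}_4$ admits a terminal collection of size at most $16\cdot\mathsf{high}(G)$, where $\mathsf{high}(G)=\sum_{v\in V_4}\deg_G(v)$.
   Context: All graphs are finite, simple and undirected; subcubic means maximum degree at most $3$. A path partition of $G$ is a collection of pairwise edge-disjoint paths whose edge sets together cover $E(G)$. A cycle $C$ in $G$ is a pan cycle if exactly one vertex of $C$ has degree $3$ in $G$ and all others have degree $2$ in $G$; it is a bull cycle if exactly two vertices of $C$ have degree $3$ in $G$ and all others have degree $2$ in $G$. A graph is nice if it is connected, not subcubic, has no pan cycles, and every bull cycle has length $3$. $N_G[S]$ denotes the closed neighborhood of a vertex set $S$. For a family $\mathcal{Q}$ of pairwise edge-disjoint paths in $G$, a set $U\subseteq V(G)$ is a terminal collection for $\mathcal{Q}$ if (1) $N_G[V_4]\subseteq U$; (2) both endpoints of every $P\in\mathcal{Q}$ lie in $U$; (3) for all $u,v\in U$, if two distinct paths $P_1,P_2\in\mathcal{Q}$ both visit $u$ and $v$, then at least one of $P_1,P_2$ visits another vertex $w\in U$ between $u$ and $v$ (along that path). -}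

module Defs where

open import Data.Nat using (ℕ; zero; suc; _+_; _≤_; _<_; _≟_; _≤ᵇ_)
open import Data.Bool using (Bool; true; false; T; if_then_else_)
open import Data.Fin using (Fin; toℕ)
open import Data.Fin.Subset using (Subset; _∈_; ∣_∣)
open import Data.List using (List; []; _∷_; length; filter; map; allFin; lookup; head; last)
open import Data.List.Relation.Unary.All using (All)
open import Data.List.Relation.Unary.Unique.Propositional using (Unique)
open import Data.List.Relation.Unary.Linked using (Linked)
open import Data.Maybe using (just)
open import Data.Nat.ListAction using (sum)
open import Data.Empty using (⊥)
open import Data.Product using (Σ; ∃; _×_; _,_)
open import Data.Sum using (_⊎_)
open import Relation.Binary.PropositionalEquality using (_≡_)
open import Relation.Nullary using (¬_)

record Graph (n : ℕ) : Set where
  field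
    adj    : Fin n → Fin n → Bool
    symm   : ∀ u v → adj u v ≡ adj v u
    irrefl : ∀ v → adj v v ≡ false
open Graph public

module _ {n : ℕ} (G : Graph n) where

  Adj : Fin n → Fin n → Set
  Adj u v = T (adj G u v)

  deg : Fin n → ℕ
  deg v = sum (map (λ u → if adj G v u then 1 else 0) (allFin n))

  InV4 : Fin n → Set
  InV4 v = 4 ≤ deg v

  high : ℕ
  high = sum (map (λ v → if 4 ≤ᵇ deg v then deg v else 0) (allFin n))

  data Reach : Fin n → Fin n → Set where
    here : ∀ {u} → Reach u u
    step : ∀ {u w v} → Adj u w → Reach w v → Reach u v

  Connected : Set
  Connected = ∀ u v → Reach u v

  Subcubic : Set
  Subcubic = ∀ v → deg v ≤ 3

  IsCycle : List (Fin n) → Set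
  IsCycle [] = ⊥
  IsCycle c@(x ∷ _) =
    3 ≤ length c × Unique c × Linked Adj c × (∀ y → last c ≡ just y → Adj y x)

  count3 : List (Fin n) → ℕ
  count3 c = length (filter (λ x → deg x ≟ 3) c)

  DegTwoOrThree : Fin n → Set
  DegTwoOrThree x = deg x ≡ 2 ⊎ deg x ≡ 3

  PanCycle : List (Fin n) → Set
  PanCycle c = IsCycle c × All DegTwoOrThree c × count3 c ≡ 1

  BullCycle : List (Fin n) → Set
  BullCycle c = IsCycle c × All DegTwoOrThree c × count3 c ≡ 2

  Nice : Set
  Nice = Connected × ¬ Subcubic × (∀ c → ¬ PanCycle c) × (∀ c → BullCycle c → length c ≡ 3)

  IsPath : List (Fin n) → Set
  IsPath p = 2 ≤ length p × Unique p × Linked Adj p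

data Consec {n : ℕ} : List (Fin n) → Fin n → Fin n → Set where
  here  : ∀ {a b xs} → Consec (a ∷ b ∷ xs) a b
  there : ∀ {x a b xs} → Consec xs a b → Consec (x ∷ xs) a b

UsesEdge : {n : ℕ} → List (Fin n) → Fin n → Fin n → Set
UsesEdge p a b = Consec p a b ⊎ Consec p b a

Visits : {n : ℕ} → List (Fin n) → Fin n → Set
Visits p v = Σ (Fin (length p)) λ i → lookup p i ≡ v

Endpoint : {n : ℕ} → List (Fin n) → Fin n → Set
Endpoint p x = head p ≡ just x ⊎ last p ≡ just x

Between : {n : ℕ} → List (Fin n) → Fin n → Fin n → Fin n → Set
Between p u w v = Σ (Fin (length p)) λ i → Σ (Fin (length p)) λ j → Σ (Fin (length p)) λ k →
  lookup p i ≡ u × lookup p j ≡ v × lookup p k ≡ w ×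
  ((toℕ i < toℕ k × toℕ k < toℕ j) ⊎ (toℕ j < toℕ k × toℕ k < toℕ i))

PathPartition : {n m : ℕ} → Graph n → (Fin m → List (Fin n)) → Set
PathPartition {n} {m} G P =
  (∀ i → IsPath G (P i)) ×
  (∀ i j → ¬ i ≡ j → ∀ a b → UsesEdge (P i) a b → ¬ UsesEdge (P j) a b) ×
  (∀ a b → Adj G a b → ∃ λ i → UsesEdge (P i) a b)

VisitsV4 : {n : ℕ} → Graph n → List (Fin n) → Set
VisitsV4 G p = ∃ λ v → InV4 G v × Visits p v

-- U is a terminal collection for the subfamily {P i | inQ i} of P.
-- (Distinct members of the family correspond to distinct indices.)
TerminalCollection : {n m : ℕ} → Graph n → (Fin m → List (Fin n)) →
                     (Fin m → Set) → Subset n → Set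
TerminalCollection {n} {m} G P inQ U =
  (∀ v → InV4 G v → v ∈ U × (∀ u → Adj G v u → u ∈ U)) ×
  (∀ i → inQ i → ∀ x → Endpoint (P i) x → x ∈ U) ×
  (∀ u v → u ∈ U → v ∈ U → ¬ u ≡ v →
     ∀ i j → inQ i → inQ j → ¬ i ≡ j →
     Visits (P i) u → Visits (P i) v → Visits (P j) u → Visits (P j) v →
     (∃ λ w → w ∈ U × Between (P i) u w v) ⊎ (∃ λ w → w ∈ U × Between (P j) u w v))

-- Let U consist of N[v] for every v ∈ V₄ and, for every directed edge vw with v ∈ V₄, of N[x]
-- for each endpoint x of degree at most 3 of the path through vw. Every path of 𝒫₄ has an
-- edge vw with v ∈ V₄, and vw lies on no other path, so every endpoint of a path of 𝒫₄ has
-- its closed neighbourhood in U, and |U| ≤ Σ_{v ∈ V₄} (1 + deg v + 2·4·deg v) ≤ 16·high(G).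
-- A vertex u on two distinct paths of 𝒫₄ is an endpoint of one of them, or interior to both
-- and then in V₄ since edge-disjointness gives it four distinct neighbours; either way
-- N[u] ⊆ U. So on each path the vertex next to u towards v is in U unless it is v itself,
-- and the two paths cannot both use the edge uv.
module Submission where

open import Defs
open import Data.Nat using (ℕ; zero; suc; _+_; _*_; _≤_; _<_; _≤ᵇ_; _≤?_; _<?_; z≤n; s≤s)
open import Data.Nat.Properties
open import Data.Nat.ListAction using (sum)
open import Data.Bool using (Bool; true; false; T; if_then_else_)
open import Data.Fin using (Fin; zero; suc; toℕ)
import Data.Fin as Fin
open import Data.Fin.Subset using (Subset; ∣_∣; ⁅_⁆; _∪_; ⋃; _⊆_; _-_; inside; outside; _∈_)
  renaming (⊥ to ∅)
open import Data.Fin.Subset.Properties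
  using (∣p∣≤∣x∷p∣; ∣⊥∣≡0; ∣⁅x⁆∣≡1; p⊆p∪q; q⊆p∪q; x∈⁅x⁆; x∈p∧x≢y⇒x∈p-y; x∈p⇒∣p-x∣<∣p∣)
import Data.Vec as Vec
open import Data.Vec using ([]; _∷_)
open import Data.Vec.Properties using (lookup∘tabulate; lookup⇒[]=)
open import Data.List using (List; []; _∷_; length; map; lookup; head; last; allFin)
import Data.List as List
open import Data.List.Properties using (map-tabulate)
open import Data.List.Membership.Propositional using () renaming (_∈_ to _∈ˡ_)
open import Data.List.Membership.Propositional.Properties using (∈-allFin)
open import Data.List.Relation.Unary.Any using (here; there)
open import Data.List.Relation.Unary.All as All using (All; []; _∷_)
open import Data.List.Relation.Unary.AllPairs using ([]; _∷_)
open import Data.List.Relation.Unary.Linked using (Linked; _∷_)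
open import Data.List.Relation.Unary.Unique.Propositional using (Unique)
open import Data.Maybe using (Maybe; just; nothing)
open import Data.Product using (Σ; ∃; ∃₂; _×_; _,_; proj₁; proj₂)
open import Data.Sum using (_⊎_; inj₁; inj₂)
open import Data.Empty using (⊥-elim)
open import Function using (_∘_)
open import Data.Nat.Tactic.RingSolver using (solve-∀)
open import Relation.Nullary using (¬_; yes; no)
open import Relation.Nullary.Decidable.Core using (T?)
open import Relation.Binary.Definitions using (tri<; tri≈; tri>)
open import Relation.Binary.PropositionalEquality
  using (_≡_; _≢_; refl; sym; trans; cong; cong₂; subst; ≢-sym; module ≡-Reasoning)

∣p∪q∣≤∣p∣+∣q∣ : ∀ {n} (p q : Subset n) → ∣ p ∪ q ∣ ≤ ∣ p ∣ + ∣ q ∣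
∣p∪q∣≤∣p∣+∣q∣ []            []            = z≤n
∣p∪q∣≤∣p∣+∣q∣ (inside ∷ p)  (y ∷ q)       =
  s≤s (≤-trans (∣p∪q∣≤∣p∣+∣q∣ p q) (+-monoʳ-≤ ∣ p ∣ (∣p∣≤∣x∷p∣ y q)))
∣p∪q∣≤∣p∣+∣q∣ (outside ∷ p) (inside ∷ q)  =
  ≤-trans (s≤s (∣p∪q∣≤∣p∣+∣q∣ p q)) (≤-reflexive (sym (+-suc ∣ p ∣ ∣ q ∣)))
∣p∪q∣≤∣p∣+∣q∣ (outside ∷ p) (outside ∷ q) = ∣p∪q∣≤∣p∣+∣q∣ p q

∣∅∣≤ : ∀ n k → ∣ ∅ {n} ∣ ≤ k
∣∅∣≤ n k = subst (_≤ k) (sym (∣⊥∣≡0 n)) z≤n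

∣⋃∣≤sum : ∀ {A : Set} {n} (f : A → Subset n) (xs : List A) →
          ∣ ⋃ (map f xs) ∣ ≤ sum (map (λ x → ∣ f x ∣) xs)
∣⋃∣≤sum {n = n} f []       = ∣∅∣≤ n 0
∣⋃∣≤sum         f (x ∷ xs) =
  ≤-trans (∣p∪q∣≤∣p∣+∣q∣ (f x) _) (+-monoʳ-≤ ∣ f x ∣ (∣⋃∣≤sum f xs))

∈⋃-map : ∀ {A : Set} {n} (f : A → Subset n) {xs : List A} {a} {x : Fin n} →
         a ∈ˡ xs → x ∈ f a → x ∈ ⋃ (map f xs)
∈⋃-map f {a ∷ xs} (here refl) x∈fa = p⊆p∪q (⋃ (map f xs)) x∈fa
∈⋃-map f {b ∷ xs} (there a∈)  x∈fa = q⊆p∪q (f b) _ (∈⋃-map f a∈ x∈fa)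

unique⊆⇒length≤∣p∣ : ∀ {n} {xs : List (Fin n)} {p : Subset n} →
                     Unique xs → All (_∈ p) xs → length xs ≤ ∣ p ∣
unique⊆⇒length≤∣p∣ []            []            = z≤n
unique⊆⇒length≤∣p∣ {xs = x ∷ xs} {p} (x≢xs ∷ uniq) (x∈p ∷ xs⊆p) =
  ≤-trans (s≤s (unique⊆⇒length≤∣p∣ uniq xs⊆p-x)) (x∈p⇒∣p-x∣<∣p∣ x∈p)
  where
  xs⊆p-x : All (_∈ p - x) xs
  xs⊆p-x = All.zipWith (λ (x≢y , y∈p) → x∈p∧x≢y⇒x∈p-y y∈p (≢-sym x≢y)) (x≢xs , xs⊆p)

∈-tabulate : ∀ {n} (f : Fin n → Bool) {x} → T (f x) → x ∈ Vec.tabulate f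
∈-tabulate f {x} fx with f x in eq
... | true = lookup⇒[]= x _ (trans (lookup∘tabulate f x) eq)

if-T : ∀ {A : Set} {b} {x y : A} → T b → (if b then x else y) ≡ x
if-T {b = true} _ = refl

∣tabulate∣ : ∀ {n} (f : Fin n → Bool) →
             ∣ Vec.tabulate f ∣ ≡ sum (List.tabulate (λ x → if f x then 1 else 0))
∣tabulate∣ {zero}  f = refl
∣tabulate∣ {suc n} f with f zero
... | true  = cong suc (∣tabulate∣ (f ∘ suc))
... | false = ∣tabulate∣ (f ∘ suc)

sum-map-≤-* : ∀ {A : Set} (k : ℕ) (f g : A → ℕ) → (∀ x → f x ≤ k * g x) →
              ∀ xs → sum (map f xs) ≤ k * sum (map g xs)
sum-map-≤-* k f g f≤kg []       = z≤n
sum-map-≤-* k f g f≤kg (x ∷ xs) =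
  ≤-trans (+-mono-≤ (f≤kg x) (sum-map-≤-* k f g f≤kg xs))
          (≤-reflexive (sym (*-distribˡ-+ k (g x) _)))

infix 4 _[_]=_

data _[_]=_ {A : Set} : List A → ℕ → A → Set where
  here  : ∀ {x xs} → x ∷ xs [ 0 ]= x
  there : ∀ {y x xs k} → xs [ k ]= x → y ∷ xs [ suc k ]= x

module _ {A : Set} where

  lookup-[]= : ∀ (p : List A) i → p [ toℕ i ]= lookup p i
  lookup-[]= (x ∷ p) zero    = here
  lookup-[]= (x ∷ p) (suc i) = there (lookup-[]= p i)

  []=⇒lookup : ∀ {p : List A} {k x} → p [ k ]= x →
               Σ (Fin (length p)) λ i → toℕ i ≡ k × lookup p i ≡ x
  []=⇒lookup here      = zero , refl , refl
  []=⇒lookup (there e) with []=⇒lookup e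
  ... | i , refl , p[i]≡x = suc i , refl , p[i]≡x

  []=⇒∈ : ∀ {p : List A} {k x} → p [ k ]= x → x ∈ˡ p
  []=⇒∈ here      = here refl
  []=⇒∈ (there e) = there ([]=⇒∈ e)

  []=-functional : ∀ {p : List A} {k x y} → p [ k ]= x → p [ k ]= y → x ≡ y
  []=-functional here      here      = refl
  []=-functional (there e) (there f) = []=-functional e f

  []=-injective : ∀ {p : List A} {k l x} → Unique p → p [ k ]= x → p [ l ]= x → k ≡ l
  []=-injective _              here      here      = refl
  []=-injective (x∉p ∷ _)      here      (there f) = ⊥-elim (All.lookup x∉p ([]=⇒∈ f) refl)
  []=-injective (x∉p ∷ _)      (there e) here      = ⊥-elim (All.lookup x∉p ([]=⇒∈ e) refl)
  []=-injective (_   ∷ uniq)   (there e) (there f) = cong suc ([]=-injective uniq e f)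

  []=⇒<length : ∀ {p : List A} {k x} → p [ k ]= x → k < length p
  []=⇒<length here      = s≤s z≤n
  []=⇒<length (there e) = s≤s ([]=⇒<length e)

  <length⇒[]= : ∀ (p : List A) {k} → k < length p → ∃ λ x → p [ k ]= x
  <length⇒[]= (x ∷ p) {zero}  _         = x , here
  <length⇒[]= (x ∷ p) {suc k} (s≤s k<p) with <length⇒[]= p k<p
  ... | y , e = y , there e

  [0]=⇒head : ∀ {p : List A} {x} → p [ 0 ]= x → head p ≡ just x
  [0]=⇒head here = refl

  [last]=⇒last : ∀ {p : List A} {k x} → p [ k ]= x → suc k ≡ length p → last p ≡ just x
  [last]=⇒last {x ∷ []}    here      _   = refl
  [last]=⇒last {x ∷ y ∷ p} (there e) len = [last]=⇒last e (suc-injective len)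

Visits⇒[]= : ∀ {n} {p : List (Fin n)} {x} → Visits p x → ∃ λ k → p [ k ]= x
Visits⇒[]= {p = p} (i , p[i]≡x) = toℕ i , subst (p [ toℕ i ]=_) p[i]≡x (lookup-[]= p i)

[]=⇒Consec : ∀ {n} {p : List (Fin n)} {k a b} → p [ k ]= a → p [ suc k ]= b → Consec p a b
[]=⇒Consec here      (there here) = here
[]=⇒Consec (there e) (there f)    = there ([]=⇒Consec e f)

Consec⇒R : ∀ {n} {R : Fin n → Fin n → Set} {p : List (Fin n)} {a b} →
           Linked R p → Consec p a b → R a b
Consec⇒R (Rab ∷ _)  here      = Rab
Consec⇒R (_ ∷ link) (there c) = Consec⇒R link c

module _ {n : ℕ} where

  []=⇒Between : ∀ {p : List (Fin n)} {a b c u v w} →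
                p [ a ]= u → p [ b ]= v → p [ c ]= w →
                (a < c × c < b) ⊎ (b < c × c < a) → Between p u w v
  []=⇒Between au bv cw order with []=⇒lookup au | []=⇒lookup bv | []=⇒lookup cw
  ... | i , refl , pi≡u | j , refl , pj≡v | k , refl , pk≡w =
    i , j , k , pi≡u , pj≡v , pk≡w , order

  endpoint⊎interior : ∀ {p : List (Fin n)} {k u} → Unique p → p [ k ]= u →
                      Endpoint p u ⊎ ∃₂ λ a b → Consec p a u × Consec p u b × a ≢ b
  endpoint⊎interior {k = zero} _ u₀ = inj₁ (inj₁ ([0]=⇒head u₀))
  endpoint⊎interior {p} {suc k} uniq uₖ with suc (suc k) <? length p
  ... | no  k+2≮p = inj₁ (inj₂ ([last]=⇒last uₖ (≤-antisym ([]=⇒<length uₖ) (≮⇒≥ k+2≮p))))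
  ... | yes k+2<p with <length⇒[]= p (<-trans (n<1+n k) ([]=⇒<length uₖ)) | <length⇒[]= p k+2<p
  ...   | a , aₖ | b , bₖ₊₂ =
    inj₂ (a , b , []=⇒Consec aₖ uₖ , []=⇒Consec uₖ bₖ₊₂ ,
          λ { refl → <⇒≢ (n≤1+n (suc k)) ([]=-injective uniq aₖ bₖ₊₂) })

  towards : ∀ {p : List (Fin n)} {a b u v} → p [ a ]= u → p [ b ]= v → u ≢ v →
            UsesEdge p u v ⊎ ∃ λ w → UsesEdge p u w × Between p u w v
  towards {p} {a} {b} au bv u≢v with <-cmp a b
  ... | tri≈ _ refl _ = ⊥-elim (u≢v ([]=-functional au bv))
  ... | tri< a<b _ _ with <length⇒[]= p (≤-<-trans a<b ([]=⇒<length bv))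
  ...   | w , a+1w with suc a ≟ b
  ...     | yes refl = inj₁ (inj₁ ([]=⇒Consec au bv))
  ...     | no  a+1≢b =
    inj₂ (w , inj₁ ([]=⇒Consec au a+1w) , []=⇒Between au bv a+1w (inj₁ (n<1+n a , ≤∧≢⇒< a<b a+1≢b)))
  towards {p} {suc a} {b} a+1u bv u≢v | tri> _ _ b<a+1
    with <length⇒[]= p (<-trans (n<1+n a) ([]=⇒<length a+1u)) | b ≟ a
  ... | w , aw | yes refl = inj₁ (inj₂ ([]=⇒Consec bv a+1u))
  ... | w , aw | no  b≢a  =
    inj₂ (w , inj₂ ([]=⇒Consec aw a+1u) , []=⇒Between a+1u bv aw (inj₂ (≤∧≢⇒< (≤-pred b<a+1) b≢a , n<1+n a)))

  edgeAt : ∀ {p : List (Fin n)} {k v} → 2 ≤ length p → p [ k ]= v → ∃ λ w → UsesEdge p v w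
  edgeAt {p} {k} 2≤p vₖ with suc k <? length p
  ... | yes k+1<p with <length⇒[]= p k+1<p
  ...   | w , wₖ₊₁ = w , inj₁ ([]=⇒Consec vₖ wₖ₊₁)
  edgeAt {p} {zero}  2≤p v₀ | no 1≮p = ⊥-elim (1≮p 2≤p)
  edgeAt {p} {suc k} 2≤p vₖ₊₁ | no _ with <length⇒[]= p (<-trans (n<1+n k) ([]=⇒<length vₖ₊₁))
  ... | w , wₖ = w , inj₂ ([]=⇒Consec wₖ vₖ₊₁)

module _ {n : ℕ} (G : Graph n) where

  neighbours : Fin n → Subset n
  neighbours v = Vec.tabulate (adj G v)

  N[_] : Fin n → Subset n
  N[ v ] = ⁅ v ⁆ ∪ neighbours v

  deg≡∣neighbours∣ : ∀ v → deg G v ≡ ∣ neighbours v ∣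
  deg≡∣neighbours∣ v = begin
    sum (map (λ u → if adj G v u then 1 else 0) (allFin n))
      ≡⟨ cong sum (map-tabulate {n = n} (λ u → u) (λ u → if adj G v u then 1 else 0)) ⟩
    sum (List.tabulate (λ u → if adj G v u then 1 else 0))
      ≡⟨ sym (∣tabulate∣ (adj G v)) ⟩
    ∣ neighbours v ∣ ∎
    where open ≡-Reasoning

  ∣N[v]∣≤1+deg : ∀ v → ∣ N[ v ] ∣ ≤ suc (deg G v)
  ∣N[v]∣≤1+deg v = begin
    ∣ ⁅ v ⁆ ∪ neighbours v ∣        ≤⟨ ∣p∪q∣≤∣p∣+∣q∣ ⁅ v ⁆ (neighbours v) ⟩
    ∣ ⁅ v ⁆ ∣ + ∣ neighbours v ∣    ≡⟨ cong₂ _+_ (∣⁅x⁆∣≡1 v) (sym (deg≡∣neighbours∣ v)) ⟩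
    suc (deg G v)                   ∎
    where open ≤-Reasoning

  v∈N[v] : ∀ v → v ∈ N[ v ]
  v∈N[v] v = p⊆p∪q (neighbours v) (x∈⁅x⁆ v)

  Adj⇒∈N[] : ∀ {v u} → Adj G v u → u ∈ N[ v ]
  Adj⇒∈N[] {v} vu = q⊆p∪q ⁅ v ⁆ (neighbours v) (∈-tabulate (adj G v) vu)

  Adj-sym : ∀ {u v} → Adj G u v → Adj G v u
  Adj-sym {u} {v} = subst T (symm G u v)

  distinctNeighbours⇒InV4 : ∀ {u a b c d} → Unique (a ∷ b ∷ c ∷ d ∷ []) →
    All (Adj G u) (a ∷ b ∷ c ∷ d ∷ []) → InV4 G u
  distinctNeighbours⇒InV4 {u} uniq adjacent =
    subst (4 ≤_) (sym (deg≡∣neighbours∣ u))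
      (unique⊆⇒length≤∣p∣ uniq (All.map (∈-tabulate (adj G u)) adjacent))

module Terminals {n m : ℕ} (G : Graph n) (P : Fin m → List (Fin n)) (partition : PathPartition G P) where

  private
    isPath : ∀ i → IsPath G (P i)
    isPath = proj₁ partition

    edgeDisjoint : ∀ i j → i ≢ j → ∀ a b → UsesEdge (P i) a b → ¬ UsesEdge (P j) a b
    edgeDisjoint = proj₁ (proj₂ partition)

    covers : ∀ a b → Adj G a b → ∃ λ i → UsesEdge (P i) a b
    covers = proj₂ (proj₂ partition)

    unique : ∀ i → Unique (P i)
    unique i = proj₁ (proj₂ (isPath i))

    linked : ∀ i → Linked (Adj G) (P i)
    linked i = proj₂ (proj₂ (isPath i))

  uses⇒Adj : ∀ {i a b} → UsesEdge (P i) a b → Adj G a b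
  uses⇒Adj {i} (inj₁ ab) = Consec⇒R (linked i) ab
  uses⇒Adj {i} (inj₂ ba) = Adj-sym G (Consec⇒R (linked i) ba)

  sameEdge⇒samePath : ∀ {i j a b} → UsesEdge (P i) a b → UsesEdge (P j) a b → i ≡ j
  sameEdge⇒samePath {i} {j} {a} {b} iab jab with i Fin.≟ j
  ... | yes i≡j = i≡j
  ... | no  i≢j = ⊥-elim (edgeDisjoint i j i≢j a b iab jab)

  pathThrough : ∀ {a b} → Adj G a b → Fin m
  pathThrough {a} {b} ab = proj₁ (covers a b ab)

  sharedInterior⇒InV4 : ∀ {i j u a b c d} → i ≢ j →
    Consec (P i) a u → Consec (P i) u b → a ≢ b →
    Consec (P j) c u → Consec (P j) u d → c ≢ d → InV4 G u
  sharedInterior⇒InV4 {i} {j} {u} {a} {b} {c} {d} i≢j au ub a≢b cu ud c≢d =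
    distinctNeighbours⇒InV4 G
      ((a≢b ∷ a≢c ∷ a≢d ∷ []) ∷ (b≢c ∷ b≢d ∷ []) ∷ (c≢d ∷ []) ∷ [] ∷ [])
      (uses⇒Adj (inj₂ au) ∷ uses⇒Adj (inj₁ ub) ∷ uses⇒Adj (inj₂ cu) ∷ uses⇒Adj (inj₁ ud) ∷ [])
    where
    a≢c : a ≢ c
    a≢c = λ { refl → edgeDisjoint i j i≢j u _ (inj₂ au) (inj₂ cu) }
    a≢d : a ≢ d
    a≢d = λ { refl → edgeDisjoint i j i≢j u _ (inj₂ au) (inj₁ ud) }
    b≢c : b ≢ c
    b≢c = λ { refl → edgeDisjoint i j i≢j u _ (inj₁ ub) (inj₂ cu) }
    b≢d : b ≢ d
    b≢d = λ { refl → edgeDisjoint i j i≢j u _ (inj₁ ub) (inj₁ ud) }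

  VisitsV4⇒V4Edge : ∀ {i} → VisitsV4 G (P i) → ∃₂ λ v w → InV4 G v × UsesEdge (P i) v w
  VisitsV4⇒V4Edge {i} (v , v∈V4 , visits) with Visits⇒[]= visits
  ... | _ , vₖ with edgeAt (proj₁ (isPath i)) vₖ
  ...   | w , vw = v , w , v∈V4 , vw

  lowNbhd : Fin n → Subset n
  lowNbhd x with deg G x ≤? 3
  ... | yes _ = N[ G ] x
  ... | no  _ = ∅

  endTerminals : Maybe (Fin n) → Subset n
  endTerminals (just x) = lowNbhd x
  endTerminals nothing  = ∅

  pathTerminals : List (Fin n) → Subset n
  pathTerminals p = endTerminals (head p) ∪ endTerminals (last p)

  edgeTerminals : Fin n → Fin n → Subset n
  edgeTerminals v w with T? (adj G v w)
  ... | yes vw = pathTerminals (P (pathThrough vw))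
  ... | no  _  = ∅

  terminalsAround : Fin n → Subset n
  terminalsAround v = N[ G ] v ∪ ⋃ (map (edgeTerminals v) (allFin n))

  vertexTerminals : Fin n → Subset n
  vertexTerminals v = if 4 ≤ᵇ deg G v then terminalsAround v else ∅

  U : Subset n
  U = ⋃ (map vertexTerminals (allFin n))

  ∣lowNbhd∣≤4 : ∀ x → ∣ lowNbhd x ∣ ≤ 4
  ∣lowNbhd∣≤4 x with deg G x ≤? 3
  ... | yes deg≤3 = ≤-trans (∣N[v]∣≤1+deg G x) (s≤s deg≤3)
  ... | no  _     = ∣∅∣≤ n 4

  ∣endTerminals∣≤4 : ∀ x → ∣ endTerminals x ∣ ≤ 4
  ∣endTerminals∣≤4 (just x) = ∣lowNbhd∣≤4 x
  ∣endTerminals∣≤4 nothing  = ∣∅∣≤ n 4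

  ∣pathTerminals∣≤8 : ∀ p → ∣ pathTerminals p ∣ ≤ 8
  ∣pathTerminals∣≤8 p = ≤-trans (∣p∪q∣≤∣p∣+∣q∣ (endTerminals (head p)) _)
                                (+-mono-≤ (∣endTerminals∣≤4 (head p)) (∣endTerminals∣≤4 (last p)))

  ∣edgeTerminals∣≤ : ∀ v w → ∣ edgeTerminals v w ∣ ≤ 8 * (if adj G v w then 1 else 0)
  ∣edgeTerminals∣≤ v w with T? (adj G v w)
  ... | yes vw = subst (λ k → ∣ pathTerminals (P (pathThrough vw)) ∣ ≤ 8 * k) (sym (if-T vw))
                       (∣pathTerminals∣≤8 (P (pathThrough vw)))
  ... | no  _  = ∣∅∣≤ n _

  ∣vertexTerminals∣≤ : ∀ v → ∣ vertexTerminals v ∣ ≤ 16 * (if 4 ≤ᵇ deg G v then deg G v else 0)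
  ∣vertexTerminals∣≤ v with 4 ≤ᵇ deg G v in v∈V4?
  ... | false = ∣∅∣≤ n 0
  ... | true  = begin
    ∣ N[ G ] v ∪ ⋃ (map (edgeTerminals v) (allFin n)) ∣
      ≤⟨ ∣p∪q∣≤∣p∣+∣q∣ (N[ G ] v) _ ⟩
    ∣ N[ G ] v ∣ + ∣ ⋃ (map (edgeTerminals v) (allFin n)) ∣
      ≤⟨ +-mono-≤ (∣N[v]∣≤1+deg G v) (∣⋃∣≤sum (edgeTerminals v) (allFin n)) ⟩
    suc d + sum (map (λ w → ∣ edgeTerminals v w ∣) (allFin n))
      ≤⟨ +-monoʳ-≤ (suc d) (sum-map-≤-* 8 _ _ (∣edgeTerminals∣≤ v) (allFin n)) ⟩
    suc d + 8 * d
      ≤⟨ +-monoˡ-≤ (8 * d) (+-monoˡ-≤ d 1≤d) ⟩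
    d + d + 8 * d
      ≡⟨ d+d+8d≡10d d ⟩
    10 * d
      ≤⟨ *-monoˡ-≤ d (m≤m+n 10 6) ⟩
    16 * d ∎
    where
    open ≤-Reasoning
    d : ℕ
    d = deg G v
    1≤d : 1 ≤ d
    1≤d = ≤-trans (s≤s z≤n) (≤ᵇ⇒≤ 4 d (subst T (sym v∈V4?) _))
    d+d+8d≡10d : ∀ d → d + d + 8 * d ≡ 10 * d
    d+d+8d≡10d = solve-∀

  ∣U∣≤16*high : ∣ U ∣ ≤ 16 * high G
  ∣U∣≤16*high = ≤-trans (∣⋃∣≤sum vertexTerminals (allFin n))
                        (sum-map-≤-* 16 _ _ ∣vertexTerminals∣≤ (allFin n))

  InV4⇒terminalsAround⊆U : ∀ {v} → InV4 G v → terminalsAround v ⊆ U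
  InV4⇒terminalsAround⊆U {v} v∈V4 x∈ = ∈⋃-map vertexTerminals (∈-allFin v) (included x∈)
    where
    included : terminalsAround v ⊆ vertexTerminals v
    included with 4 ≤ᵇ deg G v | ≤⇒≤ᵇ v∈V4
    ... | true | _ = λ x∈ → x∈

  InV4⇒N[]⊆U : ∀ {v} → InV4 G v → N[ G ] v ⊆ U
  InV4⇒N[]⊆U {v} v∈V4 = InV4⇒terminalsAround⊆U v∈V4 ∘ p⊆p∪q _

  edgeTerminals⊆U : ∀ {v} w → InV4 G v → edgeTerminals v w ⊆ U
  edgeTerminals⊆U {v} w v∈V4 =
    InV4⇒terminalsAround⊆U v∈V4 ∘ q⊆p∪q (N[ G ] v) _ ∘ ∈⋃-map (edgeTerminals v) (∈-allFin w)

  pathTerminals⊆edgeTerminals : ∀ {i v w} → UsesEdge (P i) v w → pathTerminals (P i) ⊆ edgeTerminals v w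
  pathTerminals⊆edgeTerminals {i} {v} {w} ivw with T? (adj G v w)
  ... | yes vw = subst (λ j → pathTerminals (P i) ⊆ pathTerminals (P j))
                       (sameEdge⇒samePath ivw (proj₂ (covers v w vw))) (λ x∈ → x∈)
  ... | no ¬vw = ⊥-elim (¬vw (uses⇒Adj ivw))

  endpoint⇒lowNbhd⊆pathTerminals : ∀ {p x} → Endpoint p x → lowNbhd x ⊆ pathTerminals p
  endpoint⇒lowNbhd⊆pathTerminals {p} (inj₁ head≡x) y∈ =
    p⊆p∪q (endTerminals (last p)) (subst (λ h → _ ∈ endTerminals h) (sym head≡x) y∈)
  endpoint⇒lowNbhd⊆pathTerminals {p} (inj₂ last≡x) y∈ =
    q⊆p∪q (endTerminals (head p)) _ (subst (λ h → _ ∈ endTerminals h) (sym last≡x) y∈)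

  endpoint⇒N[]⊆U : ∀ {i x} → VisitsV4 G (P i) → Endpoint (P i) x → N[ G ] x ⊆ U
  endpoint⇒N[]⊆U {i} {x} i∈𝒫₄ x-end with deg G x ≤? 3 | VisitsV4⇒V4Edge i∈𝒫₄
  ... | no  deg≰3 | _ = InV4⇒N[]⊆U (≰⇒> deg≰3)
  ... | yes deg≤3 | v , w , v∈V4 , ivw =
    edgeTerminals⊆U w v∈V4 ∘ pathTerminals⊆edgeTerminals ivw
      ∘ endpoint⇒lowNbhd⊆pathTerminals x-end ∘ N[]⊆lowNbhd
    where
    N[]⊆lowNbhd : N[ G ] x ⊆ lowNbhd x
    N[]⊆lowNbhd with deg G x ≤? 3
    ... | yes _     = λ y∈ → y∈
    ... | no  deg≰3 = ⊥-elim (deg≰3 deg≤3)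

  shared⇒N[]⊆U : ∀ {i j u} → i ≢ j → VisitsV4 G (P i) → VisitsV4 G (P j) →
                 Visits (P i) u → Visits (P j) u → N[ G ] u ⊆ U
  shared⇒N[]⊆U {i} {j} i≢j i∈𝒫₄ j∈𝒫₄ iu ju
    with endpoint⊎interior (unique i) (proj₂ (Visits⇒[]= iu))
       | endpoint⊎interior (unique j) (proj₂ (Visits⇒[]= ju))
  ... | inj₁ u-end | _         = endpoint⇒N[]⊆U i∈𝒫₄ u-end
  ... | inj₂ _     | inj₁ u-end = endpoint⇒N[]⊆U j∈𝒫₄ u-end
  ... | inj₂ (_ , _ , au , ub , a≢b) | inj₂ (_ , _ , cu , ud , c≢d) =
    InV4⇒N[]⊆U (sharedInterior⇒InV4 i≢j au ub a≢b cu ud c≢d)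

  separated : ∀ {u v i j} → N[ G ] u ⊆ U → u ≢ v → i ≢ j →
    Visits (P i) u → Visits (P i) v → Visits (P j) u → Visits (P j) v →
    (∃ λ w → w ∈ U × Between (P i) u w v) ⊎ (∃ λ w → w ∈ U × Between (P j) u w v)
  separated {u} {v} {i} {j} N[u]⊆U u≢v i≢j iu iv ju jv
    with towards (proj₂ (Visits⇒[]= iu)) (proj₂ (Visits⇒[]= iv)) u≢v
       | towards (proj₂ (Visits⇒[]= ju)) (proj₂ (Visits⇒[]= jv)) u≢v
  ... | inj₂ (w , uw , between) | _ = inj₁ (w , N[u]⊆U (Adj⇒∈N[] G (uses⇒Adj uw)) , between)
  ... | inj₁ _ | inj₂ (w , uw , between) = inj₂ (w , N[u]⊆U (Adj⇒∈N[] G (uses⇒Adj uw)) , between)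
  ... | inj₁ iuv | inj₁ juv = ⊥-elim (edgeDisjoint i j i≢j u v iuv juv)

  isTerminalCollection : TerminalCollection G P (λ i → VisitsV4 G (P i)) U
  isTerminalCollection =
    (λ v v∈V4 → InV4⇒N[]⊆U v∈V4 (v∈N[v] G v) , λ u vu → InV4⇒N[]⊆U v∈V4 (Adj⇒∈N[] G vu)) ,
    (λ i i∈𝒫₄ x x-end → endpoint⇒N[]⊆U i∈𝒫₄ x-end (v∈N[v] G x)) ,
    (λ u v _ _ u≢v i j i∈𝒫₄ j∈𝒫₄ i≢j iu iv ju jv →
       separated (shared⇒N[]⊆U i≢j i∈𝒫₄ j∈𝒫₄ iu ju) u≢v i≢j iu iv ju jv)

lemma13 : ∀ {n m : ℕ} (G : Graph n) → Nice G →
    (P : Fin m → List (Fin n)) → PathPartition G P →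
    ∃ λ (U : Subset n) → TerminalCollection G P (λ i → VisitsV4 G (P i)) U × ∣ U ∣ ≤ 16 * high G
lemma13 G _ P partition = U , isTerminalCollection , ∣U∣≤16*high
  where open Terminals G P partition
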